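{- Suppose that $S$ and $T$ are numerical semigroups with $\mathrm H_S(x^w)f(x)=\mathrm H_T(x)$ for some integer $w\ge 1$ and some polynomial $f\in\mathbb N[x]$. Put $Q(x)=\mathrm P_T(x)/\mathrm P_S(x^w)$. Then $Q(0)=1$, $Q(x)$ is a monic polynomial, and its nonzero coefficients alternate between $1$ and $-1$.
   Context: A numerical semigroup $S$ is a submonoid of $(\mathbb N,+)$ with finite complement. Its Hilbert series is the formal power series $\mathrm H_S(x)=\sum_{s\in S}x^s$ and its semigroup polynomial is $\mathrm P_S(x)=(1-x)\mathrm H_S(x)$, which is a polynomial. -}

module Defs where

open import Data.Bool using (Bool; true; false; if_then_else_)
open import Data.Nat as ℕ using (ℕ; zero; suc; _<_; _∸_; NonZero; _%_; _/_)
open import Data.Integer as ℤ using (ℤ; +_; -_; _*_; _+_; _-_)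
open import Data.List using (List; []; _∷_; filter)
open import Data.List.Relation.Unary.All using (All)
open import Data.Product using (Σ; _×_)
open import Data.Sum using (_⊎_)
open import Data.Unit using (⊤)
open import Relation.Nullary using (¬_)
open import Relation.Nullary.Decidable using (⌊_⌋; ¬?)
open import Relation.Binary.PropositionalEquality using (_≡_)

record NumericalSemigroup : Set where
  field
    mem      : ℕ → Bool
    zero∈    : mem 0 ≡ true
    closed   : ∀ a b → mem a ≡ true → mem b ≡ true → mem (ℕ._+_ a b) ≡ true
    cofinite : Σ ℕ λ F → ∀ n → F < n → mem n ≡ true

Series : Set
Series = ℕ → ℤ

sumTo : ℕ → (ℕ → ℤ) → ℤ
sumTo zero    g = g 0
sumTo (suc n) g = sumTo n g + g (suc n)

_⋆_ : Series → Series → Series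
(a ⋆ b) n = sumTo n (λ i → a i * b (n ∸ i))

-- Coefficient of x^n in a polynomial given by its coefficient list
-- (constant term first).
coeff : List ℤ → ℕ → ℤ
coeff []       _       = + 0
coeff (c ∷ cs) zero    = c
coeff (c ∷ cs) (suc n) = coeff cs n

poly : List ℤ → Series
poly = coeff

substPow : (w : ℕ) → .{{NonZero w}} → Series → Series
substPow w a n = if ⌊ n % w ℕ.≟ 0 ⌋ then a (n / w) else + 0

hilbert : NumericalSemigroup → Series
hilbert S n = if NumericalSemigroup.mem S n then + 1 else + 0

semigroupPoly : NumericalSemigroup → Series
semigroupPoly S = poly (+ 1 ∷ - (+ 1) ∷ []) ⋆ hilbert S

nonzeroCoeffs : List ℤ → List ℤ
nonzeroCoeffs = filter (λ c → ¬? (c ℤ.≟ + 0))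

ConsecAlternate : List ℤ → Set
ConsecAlternate []           = ⊤
ConsecAlternate (x ∷ [])     = ⊤
ConsecAlternate (x ∷ y ∷ ys) = (x + y ≡ + 0) × ConsecAlternate (y ∷ ys)

NonzeroCoeffsAlternate : List ℤ → Set
NonzeroCoeffsAlternate q =
  All (λ c → (c ≡ + 1) ⊎ (c ≡ - (+ 1))) (nonzeroCoeffs q) × ConsecAlternate (nonzeroCoeffs q)

{-# OPTIONS --safe #-}
module Submission where

-- Let e = f(x) / (1 - x^w).  By hypothesis e = H_T(x) / H_S(x^w), so
-- P_T(x) = (1 - x) e(x) P_S(x^w) and Q = (1 - x) e.  The coefficients of e are
-- natural numbers; they are nondecreasing along steps of w, because
-- (1 - x^w) e = f has nonnegative coefficients; and they equal 1 in large
-- degrees, where H_S(x^w) agrees with 1 / (1 - x^w).  Hence e is a 0/1 sequence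
-- that starts and ends with 1, and the coefficients of Q are its jumps: the
-- nonzero ones alternate between +1 and -1, starting and ending with +1.

open import Defs
open import Data.Bool using (Bool; true; false; not; if_then_else_)
open import Data.Empty using (⊥-elim)
open import Data.Integer as ℤ using (ℤ; +_; -_; _+_; _-_; _*_; +≤+)
import Data.Integer.Properties as ℤₚ
open import Data.Integer.Tactic.RingSolver using (solve-∀)
open import Data.List using (List; []; _∷_; map; last; length; applyUpTo)
open import Data.List.Properties using (length-applyUpTo)
open import Data.List.Relation.Unary.All using ([]; _∷_)
open import Data.Maybe using (just)
open import Data.Nat as ℕ using (ℕ; NonZero; zero; suc; _∸_; _≤_; _<_; z≤n; s≤s; _≤?_; _%_; _/_)
import Data.Nat.Properties as ℕₚ
open import Data.Nat.DivMod
  using (m≤n⇒[n∸m]%m≡n%m; m*n%n≡0; m<n⇒m%n≡m; 0/n≡0; m*n/n≡m; /-monoˡ-≤; m<n⇒m/n≡0; m≥n⇒m/n>0; m/n≡1+[m∸n]/n)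
open import Data.Product using (Σ; _×_; _,_; proj₁; proj₂)
open import Data.Sum using (_⊎_; inj₁; inj₂)
open import Data.Unit using (⊤; tt)
open import Function using (_∘_)
open import Relation.Nullary using (¬_; Dec; yes; no)
open import Relation.Binary.PropositionalEquality
  using (_≡_; refl; sym; trans; cong; cong₂; subst; subst₂; _≗_; module ≡-Reasoning)

sumTo-cong : ∀ n {g h : ℕ → ℤ} → (∀ i → i ≤ n → g i ≡ h i) → sumTo n g ≡ sumTo n h
sumTo-cong zero    g≡h = g≡h 0 z≤n
sumTo-cong (suc n) g≡h =
  cong₂ _+_ (sumTo-cong n (λ i i≤n → g≡h i (ℕₚ.m≤n⇒m≤1+n i≤n))) (g≡h (suc n) ℕₚ.≤-refl)

sumTo-suc : ∀ n (g : ℕ → ℤ) → sumTo (suc n) g ≡ g 0 + sumTo n (g ∘ suc)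
sumTo-suc zero    g = refl
sumTo-suc (suc n) g =
  trans (cong (_+ g (suc (suc n))) (sumTo-suc n g)) (ℤₚ.+-assoc (g 0) _ _)

sumTo-reverse : ∀ n (g : ℕ → ℤ) → sumTo n g ≡ sumTo n (λ i → g (n ∸ i))
sumTo-reverse zero    g = refl
sumTo-reverse (suc n) g = begin
  sumTo n g + g (suc n)                    ≡⟨ cong (_+ g (suc n)) (sumTo-reverse n g) ⟩
  sumTo n (λ i → g (n ∸ i)) + g (suc n)    ≡⟨ ℤₚ.+-comm _ (g (suc n)) ⟩
  g (suc n) + sumTo n (λ i → g (n ∸ i))    ≡⟨ sumTo-suc n (λ i → g (suc n ∸ i)) ⟨
  sumTo (suc n) (λ i → g (suc n ∸ i))      ∎
  where open ≡-Reasoning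

sumTo-zero : ∀ n (g : ℕ → ℤ) → (∀ i → g i ≡ + 0) → sumTo n g ≡ + 0
sumTo-zero zero    g g≡0 = g≡0 0
sumTo-zero (suc n) g g≡0 = cong₂ _+_ (sumTo-zero n g g≡0) (g≡0 (suc n))

sumTo-minus : ∀ n (g h : ℕ → ℤ) → sumTo n (λ i → g i - h i) ≡ sumTo n g - sumTo n h
sumTo-minus zero    g h = refl
sumTo-minus (suc n) g h =
  trans (cong (_+ (g (suc n) - h (suc n))) (sumTo-minus n g h))
        (interchange (sumTo n g) (sumTo n h) (g (suc n)) (h (suc n)))
  where
  interchange : ∀ a b c d → (a - b) + (c - d) ≡ (a + c) - (b + d)
  interchange = solve-∀

Natural : ℤ → Set
Natural z = Σ ℕ λ k → z ≡ + k

sumTo-natural : ∀ n (g : ℕ → ℤ) → (∀ i → Natural (g i)) → Natural (sumTo n g)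
sumTo-natural zero    g nat = nat 0
sumTo-natural (suc n) g nat =
  let (a , ga) = sumTo-natural n g nat ; (b , gb) = nat (suc n)
  in a ℕ.+ b , trans (cong₂ _+_ ga gb) (sym (ℤₚ.pos-+ a b))

*-natural : ∀ {x y} → Natural x → Natural y → Natural (x * y)
*-natural (a , refl) (b , refl) = a ℕ.* b , sym (ℤₚ.pos-* a b)

one : Series
one zero    = + 1
one (suc _) = + 0

allOnes : Series
allOnes _ = + 1

-- shift k a = x^k a  and  Δ k a = (1 - x^k) a.
shift : ℕ → Series → Series
shift zero    a n       = a n
shift (suc k) a zero    = + 0
shift (suc k) a (suc n) = shift k a n

Δ : ℕ → Series → Series
Δ k a n = a n - shift k a n

shift-cong : ∀ k {a b : Series} → a ≗ b → shift k a ≗ shift k b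
shift-cong zero    a≗b n       = a≗b n
shift-cong (suc k) a≗b zero    = refl
shift-cong (suc k) a≗b (suc n) = shift-cong k a≗b n

shift-< : ∀ k (a : Series) n → n < k → shift k a n ≡ + 0
shift-< (suc k) a zero    _       = refl
shift-< (suc k) a (suc n) (s≤s p) = shift-< k a n p

shift-≥ : ∀ k (a : Series) n → k ≤ n → shift k a n ≡ a (n ∸ k)
shift-≥ zero    a n       _       = refl
shift-≥ (suc k) a (suc n) (s≤s p) = shift-≥ k a n p

shift-suc : ∀ k (a : Series) → shift (suc k) a ≗ shift 1 (shift k a)
shift-suc k a zero    = refl
shift-suc k a (suc n) = refl

Δ-cong : ∀ k {a b : Series} → a ≗ b → Δ k a ≗ Δ k b
Δ-cong k a≗b n = cong₂ _-_ (a≗b n) (shift-cong k a≗b n)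

⋆-cong : ∀ {a a′ b b′ : Series} → a ≗ a′ → b ≗ b′ → a ⋆ b ≗ a′ ⋆ b′
⋆-cong a≗a′ b≗b′ n = sumTo-cong n (λ i _ → cong₂ _*_ (a≗a′ i) (b≗b′ (n ∸ i)))

⋆-comm : ∀ (a b : Series) → a ⋆ b ≗ b ⋆ a
⋆-comm a b n = trans (sumTo-reverse n _) (sumTo-cong n swap)
  where
  swap : ∀ i → i ≤ n → a (n ∸ i) * b (n ∸ (n ∸ i)) ≡ b i * a (n ∸ i)
  swap i i≤n = trans (cong (λ j → a (n ∸ i) * b j) (ℕₚ.m∸[m∸n]≡n i≤n)) (ℤₚ.*-comm (a (n ∸ i)) (b i))

⋆-identityˡ : ∀ (a : Series) → one ⋆ a ≗ a
⋆-identityˡ a zero    = ℤₚ.*-identityˡ (a 0)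
⋆-identityˡ a (suc n) = begin
  sumTo (suc n) (λ i → one i * a (suc n ∸ i))
    ≡⟨ sumTo-suc n _ ⟩
  + 1 * a (suc n) + sumTo n (λ i → + 0 * a (n ∸ i))
    ≡⟨ cong₂ _+_ (ℤₚ.*-identityˡ (a (suc n))) (sumTo-zero n (λ i → + 0 * a (n ∸ i)) (λ _ → refl)) ⟩
  a (suc n) + + 0
    ≡⟨ ℤₚ.+-identityʳ _ ⟩
  a (suc n)
    ∎
  where open ≡-Reasoning

⋆-identityʳ : ∀ (a : Series) → a ⋆ one ≗ a
⋆-identityʳ a n = trans (⋆-comm a one n) (⋆-identityˡ a n)

⋆-shift1 : ∀ (a b : Series) → a ⋆ shift 1 b ≗ shift 1 (a ⋆ b)
⋆-shift1 a b zero    = ℤₚ.*-zeroʳ (a 0)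
⋆-shift1 a b (suc n) = begin
  sumTo n (λ i → a i * shift 1 b (suc n ∸ i)) + a (suc n) * shift 1 b (n ∸ n)
    ≡⟨ cong₂ _+_ (sumTo-cong n (λ i i≤n → cong (λ j → a i * shift 1 b j) (ℕₚ.+-∸-assoc 1 i≤n)))
                 (trans (cong (λ j → a (suc n) * shift 1 b j) (ℕₚ.n∸n≡0 n)) (ℤₚ.*-zeroʳ (a (suc n)))) ⟩
  (a ⋆ b) n + + 0
    ≡⟨ ℤₚ.+-identityʳ _ ⟩
  (a ⋆ b) n
    ∎
  where open ≡-Reasoning

⋆-shift : ∀ k (a b : Series) → a ⋆ shift k b ≗ shift k (a ⋆ b)
⋆-shift zero    a b n = refl
⋆-shift (suc k) a b n = begin
  (a ⋆ shift (suc k) b) n          ≡⟨ ⋆-cong {a} {a} (λ _ → refl) (shift-suc k b) n ⟩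
  (a ⋆ shift 1 (shift k b)) n      ≡⟨ ⋆-shift1 a (shift k b) n ⟩
  shift 1 (a ⋆ shift k b) n        ≡⟨ shift-cong 1 (⋆-shift k a b) n ⟩
  shift 1 (shift k (a ⋆ b)) n      ≡⟨ shift-suc k (a ⋆ b) n ⟨
  shift (suc k) (a ⋆ b) n          ∎
  where open ≡-Reasoning

⋆-Δʳ : ∀ k (a b : Series) → a ⋆ Δ k b ≗ Δ k (a ⋆ b)
⋆-Δʳ k a b n = begin
  sumTo n (λ i → a i * (b (n ∸ i) - shift k b (n ∸ i)))
    ≡⟨ sumTo-cong n (λ i _ → distrib (a i) _ _) ⟩
  sumTo n (λ i → a i * b (n ∸ i) - a i * shift k b (n ∸ i))
    ≡⟨ sumTo-minus n _ _ ⟩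
  (a ⋆ b) n - (a ⋆ shift k b) n
    ≡⟨ cong (λ x → (a ⋆ b) n - x) (⋆-shift k a b n) ⟩
  Δ k (a ⋆ b) n
    ∎
  where
  open ≡-Reasoning
  distrib : ∀ x y z → x * (y - z) ≡ x * y - x * z
  distrib = solve-∀

⋆-Δˡ : ∀ k (a b : Series) → Δ k a ⋆ b ≗ Δ k (a ⋆ b)
⋆-Δˡ k a b n =
  trans (⋆-comm (Δ k a) b n) (trans (⋆-Δʳ k b a n) (Δ-cong k (⋆-comm b a) n))

⋆-natural : ∀ (a b : Series) → (∀ n → Natural (a n)) → (∀ n → Natural (b n)) → ∀ n → Natural ((a ⋆ b) n)
⋆-natural a b natA natB n = sumTo-natural n _ (λ i → *-natural (natA i) (natB (n ∸ i)))

⋆-agree-beyond : ∀ (a b c : Series) ℓ L → (∀ i → ℓ ≤ i → a i ≡ + 0) → (∀ j → L ≤ j → b j ≡ c j) →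
  ∀ m → L ℕ.+ ℓ ≤ m → (a ⋆ b) m ≡ (a ⋆ c) m
⋆-agree-beyond a b c ℓ L vanish agree m L+ℓ≤m = sumTo-cong m termwise
  where
  termwise : ∀ i → i ≤ m → a i * b (m ∸ i) ≡ a i * c (m ∸ i)
  termwise i _ with ℓ ≤? i
  ... | yes ℓ≤i = trans (cong (_* b (m ∸ i)) (vanish i ℓ≤i)) (sym (cong (_* c (m ∸ i)) (vanish i ℓ≤i)))
  ... | no ℓ≰i  = cong (a i *_) (agree (m ∸ i) (ℕₚ.m+n≤o⇒m≤o∸n L
                    (ℕₚ.≤-trans (ℕₚ.+-monoʳ-≤ L (ℕₚ.<⇒≤ (ℕₚ.≰⇒> ℓ≰i))) L+ℓ≤m)))

Δ1-allOnes : Δ 1 allOnes ≗ one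
Δ1-allOnes zero    = refl
Δ1-allOnes (suc n) = refl

oneMinusX-⋆ : ∀ (a : Series) → poly (+ 1 ∷ - (+ 1) ∷ []) ⋆ a ≗ Δ 1 a
oneMinusX-⋆ a n = begin
  (poly (+ 1 ∷ - (+ 1) ∷ []) ⋆ a) n   ≡⟨ ⋆-cong {b = a} {b′ = a} oneMinusX (λ _ → refl) n ⟩
  (Δ 1 one ⋆ a) n                     ≡⟨ ⋆-Δˡ 1 one a n ⟩
  Δ 1 (one ⋆ a) n                     ≡⟨ Δ-cong 1 (⋆-identityˡ a) n ⟩
  Δ 1 a n                             ∎
  where
  open ≡-Reasoning
  oneMinusX : poly (+ 1 ∷ - (+ 1) ∷ []) ≗ Δ 1 one
  oneMinusX zero          = refl
  oneMinusX (suc zero)    = refl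
  oneMinusX (suc (suc n)) = refl

coeff-≥length : ∀ (xs : List ℤ) i → length xs ≤ i → coeff xs i ≡ + 0
coeff-≥length []       i       _       = refl
coeff-≥length (x ∷ xs) (suc i) (s≤s p) = coeff-≥length xs i p

poly-natural : ∀ (f : List ℕ) i → Natural (poly (map +_ f) i)
poly-natural []      i       = 0 , refl
poly-natural (k ∷ f) zero    = k , refl
poly-natural (k ∷ f) (suc i) = poly-natural f i

substPow-divisible : ∀ w .{{_ : NonZero w}} (a : Series) n → n % w ≡ 0 → substPow w a n ≡ a (n / w)
substPow-divisible w a n w∣n with n % w ℕ.≟ 0
... | yes _   = refl
... | no w∤n  = ⊥-elim (w∤n w∣n)

substPow-indivisible : ∀ w .{{_ : NonZero w}} (a : Series) n → ¬ n % w ≡ 0 → substPow w a n ≡ + 0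
substPow-indivisible w a n w∤n with n % w ℕ.≟ 0
... | yes w∣n = ⊥-elim (w∤n w∣n)
... | no _    = refl

-- Splitting on this, unlike on n % w ℕ.≟ 0, leaves substPow in the goal intact.
divisible? : ∀ w .{{_ : NonZero w}} n → Dec (n % w ≡ 0)
divisible? w n with n % w
... | zero  = yes refl
... | suc _ = no λ ()

0%n≡0 : ∀ n .{{_ : NonZero n}} → 0 % n ≡ 0
0%n≡0 n = m*n%n≡0 0 n

substPow-cong : ∀ w .{{_ : NonZero w}} {a b : Series} → a ≗ b → substPow w a ≗ substPow w b
substPow-cong w {a} {b} a≗b n with divisible? w n
... | yes w∣n = trans (substPow-divisible w a n w∣n)
                  (trans (a≗b (n / w)) (sym (substPow-divisible w b n w∣n)))
... | no w∤n  = trans (substPow-indivisible w a n w∤n) (sym (substPow-indivisible w b n w∤n))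

substPow-Δ : ∀ w .{{_ : NonZero w}} (a : Series) → substPow w (Δ 1 a) ≗ Δ w (substPow w a)
substPow-Δ w a n with divisible? w n
... | no w∤n = trans (substPow-indivisible w (Δ 1 a) n w∤n)
                 (sym (cong₂ _-_ (substPow-indivisible w a n w∤n) shifted))
  where
  shifted : shift w (substPow w a) n ≡ + 0
  shifted with w ≤? n
  ... | yes w≤n = trans (shift-≥ w _ n w≤n)
                    (substPow-indivisible w a (n ∸ w) (w∤n ∘ trans (sym (m≤n⇒[n∸m]%m≡n%m w≤n))))
  ... | no w≰n  = shift-< w _ n (ℕₚ.≰⇒> w≰n)
... | yes w∣n = trans (substPow-divisible w (Δ 1 a) n w∣n)
                  (cong₂ _-_ (sym (substPow-divisible w a n w∣n)) shifted)
  where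
  shifted : shift 1 a (n / w) ≡ shift w (substPow w a) n
  shifted with w ≤? n
  ... | yes w≤n = begin
    shift 1 a (n / w)                 ≡⟨ cong (shift 1 a) (m/n≡1+[m∸n]/n w≤n) ⟩
    a ((n ∸ w) / w)                   ≡⟨ substPow-divisible w a (n ∸ w) (trans (m≤n⇒[n∸m]%m≡n%m w≤n) w∣n) ⟨
    substPow w a (n ∸ w)              ≡⟨ shift-≥ w _ n w≤n ⟨
    shift w (substPow w a) n          ∎
    where open ≡-Reasoning
  ... | no w≰n  = trans (cong (shift 1 a) (m<n⇒m/n≡0 (ℕₚ.≰⇒> w≰n)))
                    (sym (shift-< w _ n (ℕₚ.≰⇒> w≰n)))

substPow-one : ∀ w .{{_ : NonZero w}} → substPow w one ≗ one
substPow-one w zero = trans (substPow-divisible w one 0 (0%n≡0 w)) (cong one (0/n≡0 w))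
substPow-one w (suc n) with divisible? w (suc n)
... | no w∤n  = substPow-indivisible w one (suc n) w∤n
... | yes w∣n = trans (substPow-divisible w one (suc n) w∣n) (one-positive (m≥n⇒m/n>0 w≤1+n))
  where
  one-positive : ∀ {q} → 0 < q → one q ≡ + 0
  one-positive {suc q} _ = refl
  w≤1+n : w ≤ suc n
  w≤1+n with w ≤? suc n
  ... | yes w≤1+n = w≤1+n
  ... | no w≰1+n  = ⊥-elim (ℕₚ.1+n≢0 (trans (sym (m<n⇒m%n≡m (ℕₚ.≰⇒> w≰1+n))) w∣n))

Δ-substPow-allOnes : ∀ w .{{_ : NonZero w}} → Δ w (substPow w allOnes) ≗ one
Δ-substPow-allOnes w n = begin
  Δ w (substPow w allOnes) n     ≡⟨ substPow-Δ w allOnes n ⟨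
  substPow w (Δ 1 allOnes) n     ≡⟨ substPow-cong w Δ1-allOnes n ⟩
  substPow w one n               ≡⟨ substPow-one w n ⟩
  one n                          ∎
  where open ≡-Reasoning

substPow-natural : ∀ w .{{_ : NonZero w}} (a : Series) → (∀ n → Natural (a n)) → ∀ n → Natural (substPow w a n)
substPow-natural w a nat n with divisible? w n
... | yes w∣n = subst Natural (sym (substPow-divisible w a n w∣n)) (nat (n / w))
... | no w∤n  = 0 , substPow-indivisible w a n w∤n

substPow-agree-beyond : ∀ w .{{_ : NonZero w}} (a b : Series) F →
  (∀ m → F < m → a m ≡ b m) → ∀ n → w ℕ.* suc F ≤ n → substPow w a n ≡ substPow w b n
substPow-agree-beyond w a b F agree n wF≤n with divisible? w n
... | yes w∣n = trans (substPow-divisible w a n w∣n)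
                  (trans (agree (n / w) F<n/w) (sym (substPow-divisible w b n w∣n)))
  where
  F<n/w : F < n / w
  F<n/w = begin
    suc F              ≡⟨ m*n/n≡m (suc F) w ⟨
    suc F ℕ.* w / w    ≡⟨ cong (_/ w) (ℕₚ.*-comm (suc F) w) ⟩
    w ℕ.* suc F / w    ≤⟨ /-monoˡ-≤ w wF≤n ⟩
    n / w              ∎
    where open ℕₚ.≤-Reasoning
... | no w∤n  = trans (substPow-indivisible w a n w∤n) (sym (substPow-indivisible w b n w∤n))

EventuallyOne : Series → Set
EventuallyOne e = Σ ℕ λ B → ∀ m → B ≤ m → e m ≡ + 1

ZeroOne : ℤ → Set
ZeroOne z = z ≡ + 0 ⊎ z ≡ + 1

zeroOne-of-nondecreasing : ∀ w .{{_ : NonZero w}} (e : Series) → (∀ n → Natural (e n)) →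
  (∀ n → e n ℤ.≤ e (w ℕ.+ n)) → EventuallyOne e → ∀ n → ZeroOne (e n)
zeroOne-of-nondecreasing w e nat step (B , tail) n with nat n
... | a , e≡a = bound a e≡a (ℤₚ.drop‿+≤+ (subst₂ ℤ._≤_ e≡a (tail (B ℕ.* w ℕ.+ n) far) (iterate B)))
  where
  far : B ≤ B ℕ.* w ℕ.+ n
  far = ℕₚ.≤-trans (ℕₚ.m≤m*n B w) (ℕₚ.m≤m+n (B ℕ.* w) n)
  iterate : ∀ K → e n ℤ.≤ e (K ℕ.* w ℕ.+ n)
  iterate zero    = ℤₚ.≤-refl
  iterate (suc K) = ℤₚ.≤-trans (iterate K)
    (subst (λ m → e (K ℕ.* w ℕ.+ n) ℤ.≤ e m) (sym (ℕₚ.+-assoc w (K ℕ.* w) n)) (step (K ℕ.* w ℕ.+ n)))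
  bound : ∀ a → e n ≡ + a → a ≤ 1 → ZeroOne (e n)
  bound zero          e≡0 _ = inj₁ e≡0
  bound (suc zero)    e≡1 _ = inj₂ e≡1
  bound (suc (suc a)) _   (s≤s ())

toℤ : Bool → ℤ
toℤ false = + 0
toℤ true  = + 1

-- jumps p g m = [ toℤ (g i) - toℤ (g (i - 1)) | i < m ], reading g (-1) as p.
jumps : Bool → (ℕ → Bool) → ℕ → List ℤ
jumps p g zero    = []
jumps p g (suc m) = (toℤ (g 0) - toℤ p) ∷ jumps (g 0) (g ∘ suc) m

jumpFrom : Bool → ℤ
jumpFrom false = + 1
jumpFrom true  = - (+ 1)

HeadIs : ℤ → List ℤ → Set
HeadIs c []      = ⊤
HeadIs c (x ∷ _) = x ≡ c

AlternatingFrom : Bool → List ℤ → Set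
AlternatingFrom p xs = NonzeroCoeffsAlternate xs × HeadIs (jumpFrom p) (nonzeroCoeffs xs)

consAlternate : ∀ p ys → ConsecAlternate ys → HeadIs (jumpFrom (not p)) ys →
  ConsecAlternate (jumpFrom p ∷ ys)
consAlternate p     []       _   _    = tt
consAlternate false (y ∷ ys) alt refl = refl , alt
consAlternate true  (y ∷ ys) alt refl = refl , alt

jumps-alternating : ∀ p g m → AlternatingFrom p (jumps p g m)
jumps-alternating p g zero = ([] , tt) , tt
jumps-alternating p g (suc m) with jumps-alternating (g 0) (g ∘ suc) m
jumps-alternating false g (suc m) | ih with g 0
... | false = ih
... | true  = let ((units , alt) , head) = ih in (inj₁ refl ∷ units , consAlternate false _ alt head) , refl
jumps-alternating true  g (suc m) | ih with g 0
... | true  = ih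
... | false = let ((units , alt) , head) = ih in (inj₂ refl ∷ units , consAlternate true _ alt head) , refl

applyUpTo-jumps : ∀ (h : Series) p g m → h 0 ≡ toℤ (g 0) - toℤ p →
  (∀ i → h (suc i) ≡ toℤ (g (suc i)) - toℤ (g i)) → applyUpTo h m ≡ jumps p g m
applyUpTo-jumps h p g zero    _   _    = refl
applyUpTo-jumps h p g (suc m) at0 atSuc =
  cong₂ _∷_ at0 (applyUpTo-jumps (h ∘ suc) (g 0) (g ∘ suc) m (atSuc 0) (atSuc ∘ suc))

coeff-applyUpTo : ∀ (h : Series) m n → n < m → coeff (applyUpTo h m) n ≡ h n
coeff-applyUpTo h (suc m) zero    _       = refl
coeff-applyUpTo h (suc m) (suc n) (s≤s p) = coeff-applyUpTo (h ∘ suc) m n p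

last-applyUpTo : ∀ (h : Series) m → last (applyUpTo h (suc m)) ≡ just (h m)
last-applyUpTo h zero    = refl
last-applyUpTo h (suc m) = last-applyUpTo (h ∘ suc) m

finalRun : ∀ (b : ℕ → Bool) B → (∀ m → B ≤ m → b m ≡ true) →
  Σ ℕ λ N → (∀ m → N ≤ m → b m ≡ true) × Δ 1 (toℤ ∘ b) N ≡ + 1
finalRun b zero    tail = 0 , tail , cong (λ β → toℤ β - + 0) (tail 0 z≤n)
finalRun b (suc B) tail with b B in bB
... | false = suc B , tail , cong₂ (λ β γ → toℤ β - toℤ γ) (tail (suc B) ℕₚ.≤-refl) bB
... | true  = finalRun b B tail′
  where
  tail′ : ∀ m → B ≤ m → b m ≡ true
  tail′ m B≤m with ℕₚ.m≤n⇒m<n∨m≡n B≤m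
  ... | inj₁ B<m  = tail m B<m
  ... | inj₂ refl = bB

jumpPolynomial : ∀ (b : ℕ → Bool) B → (∀ m → B ≤ m → b m ≡ true) →
  Σ (List ℤ) λ Q → poly Q ≗ Δ 1 (toℤ ∘ b) × last Q ≡ just (+ 1) × NonzeroCoeffsAlternate Q
jumpPolynomial b B tail with finalRun b B tail
... | N , final , jump =
  applyUpTo h (suc N) , coeffs , trans (last-applyUpTo h N) (cong just jump) , alternating
  where
  h : Series
  h = Δ 1 (toℤ ∘ b)
  constant : ∀ n → N < n → h n ≡ + 0
  constant (suc n) N<1+n rewrite final (suc n) (ℕₚ.<⇒≤ N<1+n) | final n (ℕₚ.≤-pred N<1+n) = refl
  coeffs : poly (applyUpTo h (suc N)) ≗ h
  coeffs n with n ≤? N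
  ... | yes n≤N = coeff-applyUpTo h (suc N) n (s≤s n≤N)
  ... | no n≰N  = trans (coeff-≥length _ n (ℕₚ.≤-trans (ℕₚ.≤-reflexive (length-applyUpTo h (suc N))) (ℕₚ.≰⇒> n≰N)))
                        (sym (constant n (ℕₚ.≰⇒> n≰N)))
  alternating : NonzeroCoeffsAlternate (applyUpTo h (suc N))
  alternating = subst NonzeroCoeffsAlternate (sym (applyUpTo-jumps h false b (suc N) refl (λ _ → refl)))
                      (proj₁ (jumps-alternating false b (suc N)))

toℤ≡1⇒true : ∀ {β} → toℤ β ≡ + 1 → β ≡ true
toℤ≡1⇒true {true} _ = refl

zeroOne-jumpPolynomial : ∀ (e : Series) → (∀ n → ZeroOne (e n)) → EventuallyOne e →
  Σ (List ℤ) λ Q → poly Q ≗ Δ 1 e × last Q ≡ just (+ 1) × NonzeroCoeffsAlternate Q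
zeroOne-jumpPolynomial e zeroOne (B , tail) =
  let (Q , coeffs , lastQ , alternating) = jumpPolynomial b B tailᵇ
  in Q , (λ n → trans (coeffs n) (sym (Δ-cong 1 e≗b n))) , lastQ , alternating
  where
  asBool : ∀ {z} → ZeroOne z → Σ Bool λ β → z ≡ toℤ β
  asBool (inj₁ z≡0) = false , z≡0
  asBool (inj₂ z≡1) = true , z≡1
  b : ℕ → Bool
  b n = proj₁ (asBool (zeroOne n))
  e≗b : e ≗ toℤ ∘ b
  e≗b n = proj₂ (asBool (zeroOne n))
  tailᵇ : ∀ m → B ≤ m → b m ≡ true
  tailᵇ m B≤m = toℤ≡1⇒true (trans (sym (e≗b m)) (tail m B≤m))

hilbert-one : ∀ S m → NumericalSemigroup.mem S m ≡ true → hilbert S m ≡ + 1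
hilbert-one S m m∈S = cong (λ β → if β then + 1 else + 0) m∈S

hilbert-cofinite : ∀ S m → proj₁ (NumericalSemigroup.cofinite S) < m → hilbert S m ≡ + 1
hilbert-cofinite S m F<m = hilbert-one S m (proj₂ (NumericalSemigroup.cofinite S) m F<m)

module Quotient (S T : NumericalSemigroup) (w : ℕ) .{{_ : NonZero w}} (f : List ℕ)
                (hyp : substPow w (hilbert S) ⋆ poly (map +_ f) ≗ hilbert T) where

  F G I e : Series
  F = poly (map +_ f)
  G = substPow w (hilbert S)
  I = substPow w allOnes
  e = F ⋆ I

  Δ-e : Δ w e ≗ F
  Δ-e n = begin
    Δ w (F ⋆ I) n     ≡⟨ ⋆-Δʳ w F I n ⟨
    (F ⋆ Δ w I) n     ≡⟨ ⋆-cong {F} {F} (λ _ → refl) (Δ-substPow-allOnes w) n ⟩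
    (F ⋆ one) n       ≡⟨ ⋆-identityʳ F n ⟩
    F n               ∎
    where open ≡-Reasoning

  e-natural : ∀ n → Natural (e n)
  e-natural = ⋆-natural F I (poly-natural f) (substPow-natural w allOnes (λ _ → 1 , refl))

  e-nondecreasing : ∀ n → e n ℤ.≤ e (w ℕ.+ n)
  e-nondecreasing n with poly-natural f (w ℕ.+ n)
  ... | k , F≡k = ℤₚ.0≤i-j⇒j≤i (subst (ℤ.0ℤ ℤ.≤_) (sym increment) (+≤+ z≤n))
    where
    open ≡-Reasoning
    increment : e (w ℕ.+ n) - e n ≡ + k
    increment = begin
      e (w ℕ.+ n) - e n                     ≡⟨ cong (λ m → e (w ℕ.+ n) - e m) (ℕₚ.m+n∸m≡n w n) ⟨
      e (w ℕ.+ n) - e (w ℕ.+ n ∸ w)         ≡⟨ cong (λ x → e (w ℕ.+ n) - x) (shift-≥ w e (w ℕ.+ n) (ℕₚ.m≤m+n w n)) ⟨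
      Δ w e (w ℕ.+ n)                       ≡⟨ Δ-e (w ℕ.+ n) ⟩
      F (w ℕ.+ n)                           ≡⟨ F≡k ⟩
      + k                                   ∎

  e-eventually-one : EventuallyOne e
  e-eventually-one = suc FT ℕ.+ (L ℕ.+ ℓ) , e≡1
    where
    FT = proj₁ (NumericalSemigroup.cofinite T)
    L  = w ℕ.* suc (proj₁ (NumericalSemigroup.cofinite S))
    ℓ  = length (map +_ f)
    G-tail : ∀ j → L ≤ j → G j ≡ I j
    G-tail = substPow-agree-beyond w (hilbert S) allOnes _ (hilbert-cofinite S)
    e≡1 : ∀ m → suc FT ℕ.+ (L ℕ.+ ℓ) ≤ m → e m ≡ + 1
    e≡1 m far = begin
      e m            ≡⟨ ⋆-agree-beyond F G I ℓ L (coeff-≥length (map +_ f)) G-tail m (ℕₚ.m+n≤o⇒n≤o (suc FT) far) ⟨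
      (F ⋆ G) m      ≡⟨ ⋆-comm F G m ⟩
      (G ⋆ F) m      ≡⟨ hyp m ⟩
      hilbert T m    ≡⟨ hilbert-cofinite T m (ℕₚ.m+n≤o⇒m≤o (suc FT) far) ⟩
      + 1            ∎
      where open ≡-Reasoning

  e-zeroOne : ∀ n → ZeroOne (e n)
  e-zeroOne = zeroOne-of-nondecreasing w e e-natural e-nondecreasing e-eventually-one

  e-at-0 : e 0 ≡ + 1
  e-at-0 = begin
    F 0 * I 0        ≡⟨ cong (F 0 *_) I₀≡G₀ ⟩
    F 0 * G 0        ≡⟨ ℤₚ.*-comm (F 0) (G 0) ⟩
    (G ⋆ F) 0        ≡⟨ hyp 0 ⟩
    hilbert T 0      ≡⟨ hilbert-one T 0 (NumericalSemigroup.zero∈ T) ⟩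
    + 1              ∎
    where
    open ≡-Reasoning
    I₀≡G₀ : I 0 ≡ G 0
    I₀≡G₀ = sym (trans (substPow-divisible w (hilbert S) 0 (0%n≡0 w))
              (trans (cong (hilbert S) (0/n≡0 w)) (trans (hilbert-one S 0 (NumericalSemigroup.zero∈ S))
                (sym (substPow-divisible w allOnes 0 (0%n≡0 w))))))

  factorisation : semigroupPoly T ≗ Δ 1 e ⋆ substPow w (semigroupPoly S)
  factorisation n = begin
    semigroupPoly T n                         ≡⟨ oneMinusX-⋆ (hilbert T) n ⟩
    Δ 1 (hilbert T) n                         ≡⟨ Δ-cong 1 e⋆ΔG≗H_T n ⟨
    Δ 1 (e ⋆ Δ w G) n                         ≡⟨ ⋆-Δˡ 1 e (Δ w G) n ⟨
    (Δ 1 e ⋆ Δ w G) n                         ≡⟨ ⋆-cong {Δ 1 e} {Δ 1 e} (λ _ → refl) P_S[xʷ]≗ΔG n ⟨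
    (Δ 1 e ⋆ substPow w (semigroupPoly S)) n  ∎
    where
    open ≡-Reasoning
    e⋆ΔG≗H_T : e ⋆ Δ w G ≗ hilbert T
    e⋆ΔG≗H_T m = begin
      (e ⋆ Δ w G) m      ≡⟨ ⋆-Δʳ w e G m ⟩
      Δ w (e ⋆ G) m      ≡⟨ Δ-cong w (⋆-comm e G) m ⟩
      Δ w (G ⋆ e) m      ≡⟨ ⋆-Δʳ w G e m ⟨
      (G ⋆ Δ w e) m      ≡⟨ ⋆-cong {G} {G} (λ _ → refl) Δ-e m ⟩
      (G ⋆ F) m          ≡⟨ hyp m ⟩
      hilbert T m        ∎
    P_S[xʷ]≗ΔG : substPow w (semigroupPoly S) ≗ Δ w G
    P_S[xʷ]≗ΔG m = trans (substPow-cong w (oneMinusX-⋆ (hilbert S)) m) (substPow-Δ w (hilbert S) m)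

mainTheorem6 : (S T : NumericalSemigroup) (w : ℕ) .{{_ : NonZero w}} (f : List ℕ) →
    (∀ n → (substPow w (hilbert S) ⋆ poly (map +_ f)) n ≡ hilbert T n) →
    Σ (List ℤ) λ Q →
      (∀ n → semigroupPoly T n ≡ (poly Q ⋆ substPow w (semigroupPoly S)) n)
      × coeff Q 0 ≡ + 1
      × last Q ≡ just (+ 1)
      × NonzeroCoeffsAlternate Q
mainTheorem6 S T w f hyp =
  let (Q , coeffs , lastQ , alternating) = zeroOne-jumpPolynomial e e-zeroOne e-eventually-one
  in Q , (λ n → trans (factorisation n) (sym (⋆-cong {b = substPow w (semigroupPoly S)} coeffs (λ _ → refl) n)))
       , trans (coeffs 0) (trans (ℤₚ.+-identityʳ (e 0)) e-at-0)
       , lastQ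
       , alternating
  where open Quotient S T w f hyp
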